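{- Let $G$ be a strongly antimagic graph, let $k$ be a positive integer, and let $V_k=\{v\in V(G)\mid \deg(v)=k\}$. If for each vertex of $V_k$ one attaches a new pendant edge (to a new vertex, distinct for distinct vertices of $V_k$), then the resulting graph is strongly antimagic.
   Context: For a graph $G=(V,E)$ and a bijection $f:E\to\{1,2,\dots,|E|\}$, the vertex-sum at $u$ is $\varphi_f(u)=\sum_{e\in E(u)}f(e)$, where $E(u)$ is the set of edges incident to $u$. The bijection $f$ is a strongly antimagic labeling if $\varphi_f(u)\neq\varphi_f(v)$ for all distinct vertices $u,v$, and moreover $\varphi_f(u)<\varphi_f(v)$ whenever $\deg(u)<\deg(v)$. A graph is strongly antimagic if it has a strongly antimagic labeling. -}

module Defs where

open import Data.Nat using (ℕ; zero; suc; _+_; _<_)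
open import Data.Fin using (Fin; toℕ; _↑ˡ_; _↑ʳ_; splitAt)
open import Data.Fin.Properties using (_≟_)
open import Data.Bool using (Bool; true; false; if_then_else_)
open import Data.Product using (_×_; _,_; proj₁; proj₂; Σ)
open import Data.Sum using (_⊎_; inj₁; inj₂)
open import Data.Nat.ListAction using (sum)
open import Data.List using (List; map; length; filter; allFin; lookup)
open import Relation.Nullary using (¬_; does)
open import Data.Bool using (_∨_)
open import Relation.Binary.PropositionalEquality using (_≡_; _≢_)
open import Function.Bundles using (_⤖_; Bijection)

record Graph : Set where
  field
    n    : ℕ
    m    : ℕ
    ends : Fin m → Fin n × Fin n

open Graph public

SameEnds : {n : ℕ} → Fin n × Fin n → Fin n × Fin n → Set
SameEnds (a , b) (c , d) = ((a ≡ c) × (b ≡ d)) ⊎ ((a ≡ d) × (b ≡ c))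

IsSimple : Graph → Set
IsSimple G =
  ((e : Fin (m G)) → proj₁ (ends G e) ≢ proj₂ (ends G e)) ×
  ((e e′ : Fin (m G)) → SameEnds (ends G e) (ends G e′) → e ≡ e′)

incident : (G : Graph) → Fin (m G) → Fin (n G) → Bool
incident G e v = does (proj₁ (ends G e) ≟ v) ∨ does (proj₂ (ends G e) ≟ v)

deg : (G : Graph) → Fin (n G) → ℕ
deg G v = sum (map (λ e → if incident G e v then 1 else 0) (allFin (m G)))

-- An edge labeling f : E → {1,…,|E|}, given by a bijection Fin m ⤖ Fin m;
-- the label of e is 1 + toℕ (f e).
label : (G : Graph) → Fin (m G) ⤖ Fin (m G) → Fin (m G) → ℕ
label G f e = suc (toℕ (Bijection.to f e))

φ : (G : Graph) → Fin (m G) ⤖ Fin (m G) → Fin (n G) → ℕ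
φ G f v = sum (map (λ e → if incident G e v then label G f e else 0) (allFin (m G)))

IsStronglyAntimagicLabeling : (G : Graph) → Fin (m G) ⤖ Fin (m G) → Set
IsStronglyAntimagicLabeling G f =
  ((u v : Fin (n G)) → u ≢ v → φ G f u ≢ φ G f v) ×
  ((u v : Fin (n G)) → deg G u < deg G v → φ G f u < φ G f v)

StronglyAntimagic : Graph → Set
StronglyAntimagic G = Σ (Fin (m G) ⤖ Fin (m G)) (IsStronglyAntimagicLabeling G)

Vdeg : (G : Graph) → ℕ → List (Fin (n G))
Vdeg G k = filter (λ v → deg G v Data.Nat.≟ k) (allFin (n G))

-- New vertices: Fin (n + c), where c = |V_k|; old vertex v ↦ v ↑ˡ c,
-- the i-th new vertex is n ↑ʳ i.  Edges: old edges first, then the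
-- i-th pendant edge joining the i-th vertex of V_k to the i-th new vertex.
addPendants : Graph → ℕ → Graph
addPendants G k = record
  { n = n G + c
  ; m = m G + c
  ; ends = newEnds
  }
  where
  L = Vdeg G k
  c = length L
  newEnds : Fin (m G + c) → Fin (n G + c) × Fin (n G + c)
  newEnds e with splitAt (m G) e
  ... | inj₁ e₀ = (proj₁ (ends G e₀) ↑ˡ c) , (proj₂ (ends G e₀) ↑ˡ c)
  ... | inj₂ i  = (lookup L i ↑ˡ c) , (n G ↑ʳ i)

module Submission where

-- Relabel the edges of G + pendants as follows: an old edge e gets c + f(e), where
-- c = |V_k|, and the pendant edge at v ∈ V_k gets 1 + #{u ∈ V_k | φ(u) < φ(v)}.
-- An old vertex v then has vertex-sum φ(v) + c·deg(v) + ε(v) with 0 ≤ ε(v) ≤ c,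
-- and its new degree is a nondecreasing function of deg(v). So the new sums of
-- old vertices increase strictly with (deg, φ) in lexicographic order: a step in
-- degree gains at least c, which absorbs ε, and within one degree ε is itself
-- monotone in φ. The new leaves have degree 1 and distinct sums in 1..c, below
-- every old vertex of positive degree, while an isolated vertex stays isolated
-- with sum 0 because k ≥ 1.

open import Defs

open import Data.Bool using (true; false; if_then_else_; _∨_)
open import Data.Bool.Properties using (if-cong; ∨-identityʳ)
open import Data.Fin as Fin using (Fin; toℕ; _↑ˡ_; _↑ʳ_; fromℕ<)
import Data.Fin.Properties as Fin
open import Data.List using (List; lookup; length; map; tabulate; allFin)
open import Data.List.Membership.Propositional using (_∈_)
open import Data.List.Membership.Propositional.Properties using (∈-filter⁺; ∈-filter⁻; ∈-allFin; ∈-lookup)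
import Data.List.Relation.Unary.All as All
open import Data.List.Relation.Unary.AllPairs using (_∷_)
open import Data.List.Relation.Unary.Any using (index)
open import Data.List.Relation.Unary.Any.Properties using (lookup-index)
open import Data.List.Relation.Unary.Unique.Propositional using (Unique)
import Data.List.Relation.Unary.Unique.Propositional.Properties as Unique
open import Data.Nat using (ℕ; zero; suc; _+_; _*_; _<_; _≤_; z≤n; s≤s; s≤s⁻¹; _<?_)
import Data.Nat as ℕ
open import Data.Nat.ListAction using () renaming (sum to listSum)
open import Data.Nat.Properties
open import Algebra.Properties.Semiring.Sum +-*-semiring
  using (sum; sum-syntax; sum-cong-≗; ∑-distrib-+; *-distribˡ-sum; sum-remove; sum-replicate-zero)
open import Data.Product using (_×_; _,_; proj₁; proj₂)
open import Data.Sum using (_⊎_; inj₁; inj₂; [_,_]′)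
import Data.Vec.Functional as Vec
open import Function using (_∘_; id)
open import Function.Bundles using (_⤖_; Bijection; mk⤖)
open import Function.Definitions using (Injective; Surjective)
open import Relation.Binary.Definitions using (tri<; tri≈; tri>)
open import Relation.Binary.PropositionalEquality
open import Relation.Nullary using (does; yes; no; contradiction)
open import Relation.Nullary.Decidable using (does-≡; map′; dec-true; dec-false)

private variable
  a b : ℕ

sum-tabulate : {A : Set} (g : A → ℕ) (h : Fin b → A) → listSum (map g (tabulate h)) ≡ sum (g ∘ h)
sum-tabulate {zero}  g h = refl
sum-tabulate {suc b} g h = cong (g (h Fin.zero) +_) (sum-tabulate g (h ∘ Fin.suc))

sum-↑ : (g : Fin (a + b) → ℕ) → sum g ≡ sum (g ∘ (_↑ˡ b)) + sum (g ∘ (a ↑ʳ_))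
sum-↑ {zero}  g = refl
sum-↑ {suc a} g = trans (cong (g Fin.zero +_) (sum-↑ {a} (g ∘ Fin.suc))) (sym (+-assoc (g Fin.zero) _ _))

sum-ones : ∀ b → ∑[ i < b ] 1 ≡ b
sum-ones zero    = refl
sum-ones (suc b) = cong suc (sum-ones b)

sum-mono-≤ : {g h : Fin b → ℕ} → (∀ i → g i ≤ h i) → sum g ≤ sum h
sum-mono-≤ {zero}  g≤h = z≤n
sum-mono-≤ {suc b} g≤h = +-mono-≤ (g≤h Fin.zero) (sum-mono-≤ (g≤h ∘ Fin.suc))

sum-mono-< : {g h : Fin b → ℕ} → (∀ i → g i ≤ h i) → ∀ i → g i < h i → sum g < sum h
sum-mono-< g≤h Fin.zero    g<h = +-mono-<-≤ g<h (sum-mono-≤ (g≤h ∘ Fin.suc))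
sum-mono-< g≤h (Fin.suc i) g<h = +-mono-≤-< (g≤h Fin.zero) (sum-mono-< (g≤h ∘ Fin.suc) i g<h)

sum-point : (g : Fin b → ℕ) (i : Fin b) → (∀ j → j ≢ i → g j ≡ 0) → sum g ≡ g i
sum-point {suc b} g i g≡0 = begin
  sum g                                ≡⟨ sum-remove {i = i} g ⟩
  g i + sum (Vec.removeAt g i)         ≡⟨ cong (g i +_) (sum-cong-≗ (λ j → g≡0 _ (Fin.punchInᵢ≢i i j))) ⟩
  g i + sum (Vec.replicate b 0)        ≡⟨ cong (g i +_) (sum-replicate-zero b) ⟩
  g i + 0                              ≡⟨ +-identityʳ (g i) ⟩
  g i                                  ∎
  where open ≡-Reasoning

data ↑-View (a b : ℕ) : Fin (a + b) → Set where
  ↑ˡ-view : (i : Fin a) → ↑-View a b (i ↑ˡ b)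
  ↑ʳ-view : (j : Fin b) → ↑-View a b (a ↑ʳ j)

↑-view : ∀ a {b} (x : Fin (a + b)) → ↑-View a b x
↑-view zero    x           = ↑ʳ-view x
↑-view (suc a) Fin.zero    = ↑ˡ-view Fin.zero
↑-view (suc a) (Fin.suc x) with ↑-view a x
... | ↑ˡ-view i = ↑ˡ-view (Fin.suc i)
... | ↑ʳ-view j = ↑ʳ-view j

↑ˡ≢↑ʳ : (i : Fin a) (j : Fin b) → i ↑ˡ b ≢ a ↑ʳ j
↑ˡ≢↑ʳ {a} {b} i j eq = <⇒≢ (≤-trans (Fin.toℕ<n i) (m≤m+n a (toℕ j))) (begin
  toℕ i          ≡⟨ Fin.toℕ-↑ˡ i b ⟨
  toℕ (i ↑ˡ b)   ≡⟨ cong toℕ eq ⟩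
  toℕ (a ↑ʳ j)   ≡⟨ Fin.toℕ-↑ʳ a j ⟩
  a + toℕ j      ∎)
  where open ≡-Reasoning

does-≟-injective : (h : Fin a → Fin b) → Injective _≡_ _≡_ h →
                   ∀ x y → does (h x Fin.≟ h y) ≡ does (x Fin.≟ y)
does-≟-injective h h-inj x y = does-≡ (h x Fin.≟ h y) (map′ (cong h) h-inj (x Fin.≟ y))

injective⇒surjective : (h : Fin b → Fin b) → Injective _≡_ _≡_ h → Surjective _≡_ _≡_ h
injective⇒surjective h h-inj y with Fin.any? (λ x → h x Fin.≟ y)
... | yes (x , hx≡y) = x , λ { refl → hx≡y }
injective⇒surjective {suc b} h h-inj y | no y∉image
  with Fin.pigeonhole (n<1+n b) (λ x → Fin.punchOut (y∉image ∘ (x ,_) ∘ sym))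
... | i , j , i<j , hᵢ≡hⱼ = contradiction
  (h-inj (Fin.punchOut-injective (y∉image ∘ (i ,_) ∘ sym) (y∉image ∘ (j ,_) ∘ sym) hᵢ≡hⱼ))
  (Fin.<⇒≢ i<j)

injective⇒bijection : (h : Fin b → Fin b) → Injective _≡_ _≡_ h → Fin b ⤖ Fin b
injective⇒bijection h h-inj = mk⤖ (h-inj , injective⇒surjective h h-inj)

𝟙[_<_] : ℕ → ℕ → ℕ
𝟙[ a < b ] with a <? b
... | yes _ = 1
... | no  _ = 0

𝟙<≤1 : ∀ a b → 𝟙[ a < b ] ≤ 1
𝟙<≤1 a b with a <? b
... | yes _ = ≤-refl
... | no  _ = z≤n

𝟙<-mono : ∀ {a b b′} → (a < b → a < b′) → 𝟙[ a < b ] ≤ 𝟙[ a < b′ ]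
𝟙<-mono {a} {b} {b′} imp with a <? b | a <? b′
... | yes a<b | no a≮b′ = contradiction (imp a<b) a≮b′
... | yes _   | yes _   = ≤-refl
... | no  _   | _       = z≤n

𝟙<-irrefl : ∀ a → 𝟙[ a < a ] ≡ 0
𝟙<-irrefl a with a <? a
... | yes a<a = contradiction a<a (<-irrefl refl)
... | no  _   = refl

𝟙<≡1 : ∀ {a b} → a < b → 𝟙[ a < b ] ≡ 1
𝟙<≡1 {a} {b} a<b with a <? b
... | yes _   = refl
... | no  a≮b = contradiction a<b a≮b

rank : (Fin b → ℕ) → Fin b → ℕ
rank {b} ψ i = ∑[ j < b ] 𝟙[ ψ j < ψ i ]

module _ (ψ : Fin b → ℕ) where

  rank<size : ∀ i → rank ψ i < b
  rank<size i = subst (rank ψ i <_) (sum-ones b)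
    (sum-mono-< (λ j → 𝟙<≤1 (ψ j) (ψ i)) i (subst (_< 1) (sym (𝟙<-irrefl (ψ i))) (s≤s z≤n)))

  rank-mono-< : ∀ {i j} → ψ i < ψ j → rank ψ i < rank ψ j
  rank-mono-< {i} {j} ψi<ψj =
    sum-mono-< (λ l → 𝟙<-mono (λ ψl<ψi → <-trans ψl<ψi ψi<ψj)) i
      (subst₂ _<_ (sym (𝟙<-irrefl (ψ i))) (sym (𝟙<≡1 ψi<ψj)) (s≤s z≤n))

  rank-injective : Injective _≡_ _≡_ ψ → Injective _≡_ _≡_ (rank ψ)
  rank-injective ψ-inj {i} {j} eq with <-cmp (ψ i) (ψ j)
  ... | tri< ψi<ψj _ _ = contradiction eq (<⇒≢ (rank-mono-< ψi<ψj))
  ... | tri≈ _ ψi≡ψj _ = ψ-inj ψi≡ψj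
  ... | tri> _ _ ψj<ψi = contradiction (sym eq) (<⇒≢ (rank-mono-< ψj<ψi))

Unique⇒lookup-injective : {A : Set} {xs : List A} → Unique xs → Injective _≡_ _≡_ (lookup xs)
Unique⇒lookup-injective (_ ∷ _) {Fin.zero} {Fin.zero} _ = refl
Unique⇒lookup-injective (x∉xs ∷ _) {Fin.zero} {Fin.suc j} eq = contradiction eq (All.lookup x∉xs (∈-lookup j))
Unique⇒lookup-injective (x∉xs ∷ _) {Fin.suc i} {Fin.zero} eq = contradiction (sym eq) (All.lookup x∉xs (∈-lookup i))
Unique⇒lookup-injective (_ ∷ xs!) {Fin.suc i} {Fin.suc j} eq = cong Fin.suc (Unique⇒lookup-injective xs! eq)

incidenceSum : (G : Graph) → (Fin (m G) → ℕ) → Fin (n G) → ℕ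
incidenceSum G w v = ∑[ e < m G ] (if incident G e v then w e else 0)

module _ (G : Graph) where

  deg≡incidenceSum : ∀ v → deg G v ≡ incidenceSum G (λ _ → 1) v
  deg≡incidenceSum v = sum-tabulate (λ e → if incident G e v then 1 else 0) id

  φ≡incidenceSum : ∀ f v → φ G f v ≡ incidenceSum G (label G f) v
  φ≡incidenceSum f v = sum-tabulate (λ e → if incident G e v then label G f e else 0) id

  incidenceSum-cong : ∀ {w w′} → (∀ e → w e ≡ w′ e) → ∀ v → incidenceSum G w v ≡ incidenceSum G w′ v
  incidenceSum-cong w≗w′ v = sum-cong-≗ (λ e → cong (if incident G e v then_else 0) (w≗w′ e))

  incidenceSum-+ : ∀ w w′ v → incidenceSum G (λ e → w e + w′ e) v ≡ incidenceSum G w v + incidenceSum G w′ v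
  incidenceSum-+ w w′ v = trans (sum-cong-≗ (λ e → if-+ (incident G e v)))
    (∑-distrib-+ (λ e → if incident G e v then w e else 0) (λ e → if incident G e v then w′ e else 0))
    where
    if-+ : ∀ b {x y} → (if b then x + y else 0) ≡ (if b then x else 0) + (if b then y else 0)
    if-+ true  = refl
    if-+ false = refl

  incidenceSum-* : ∀ a w v → incidenceSum G (λ e → a * w e) v ≡ a * incidenceSum G w v
  incidenceSum-* a w v = trans (sum-cong-≗ (λ e → if-* (incident G e v)))
    (sym (*-distribˡ-sum a (λ e → if incident G e v then w e else 0)))
    where
    if-* : ∀ b {x} → (if b then a * x else 0) ≡ a * (if b then x else 0)
    if-* true  = refl
    if-* false = sym (*-zeroʳ a)

  incidenceSum-mono : ∀ {w w′} → (∀ e → w e ≤ w′ e) → ∀ v → incidenceSum G w v ≤ incidenceSum G w′ v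
  incidenceSum-mono w≤w′ v = sum-mono-≤ (λ e → if-mono (incident G e v) (w≤w′ e))
    where
    if-mono : ∀ b {x y} → x ≤ y → (if b then x else 0) ≤ (if b then y else 0)
    if-mono true  x≤y = x≤y
    if-mono false _   = z≤n

  deg≤φ : ∀ f v → deg G v ≤ φ G f v
  deg≤φ f v = subst₂ _≤_ (sym (deg≡incidenceSum v)) (sym (φ≡incidenceSum f v))
    (incidenceSum-mono (λ _ → s≤s z≤n) v)

  φ≤m*deg : ∀ f v → φ G f v ≤ m G * deg G v
  φ≤m*deg f v = begin
    φ G f v                                   ≡⟨ φ≡incidenceSum f v ⟩
    incidenceSum G (label G f) v              ≤⟨ incidenceSum-mono label≤m v ⟩
    incidenceSum G (λ _ → m G * 1) v          ≡⟨ incidenceSum-* (m G) _ v ⟩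
    m G * incidenceSum G (λ _ → 1) v          ≡⟨ cong (m G *_) (deg≡incidenceSum v) ⟨
    m G * deg G v                             ∎
    where
    open ≤-Reasoning
    label≤m : ∀ e → label G f e ≤ m G * 1
    label≤m e = subst (label G f e ≤_) (sym (*-identityʳ (m G))) (Fin.toℕ<n (Bijection.to f e))

module Pendants (G : Graph) (k : ℕ) where

  N : ℕ
  N = n G

  M : ℕ
  M = m G

  L : List (Fin N)
  L = Vdeg G k

  c : ℕ
  c = length L

  H : Graph
  H = addPendants G k

  ends-↑ˡ : ∀ e → ends H (e ↑ˡ c) ≡ (proj₁ (ends G e) ↑ˡ c , proj₂ (ends G e) ↑ˡ c)
  ends-↑ˡ e rewrite Fin.splitAt-↑ˡ M e c = refl

  ends-↑ʳ : ∀ i → ends H (M ↑ʳ i) ≡ (lookup L i ↑ˡ c , N ↑ʳ i)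
  ends-↑ʳ i rewrite Fin.splitAt-↑ʳ M c i = refl

  incident-↑ˡ-↑ˡ : ∀ e v → incident H (e ↑ˡ c) (v ↑ˡ c) ≡ incident G e v
  incident-↑ˡ-↑ˡ e v rewrite ends-↑ˡ e =
    cong₂ _∨_ (does-≟-injective (_↑ˡ c) (Fin.↑ˡ-injective c _ _) (proj₁ (ends G e)) v)
              (does-≟-injective (_↑ˡ c) (Fin.↑ˡ-injective c _ _) (proj₂ (ends G e)) v)

  incident-↑ˡ-↑ʳ : ∀ e j → incident H (e ↑ˡ c) (N ↑ʳ j) ≡ false
  incident-↑ˡ-↑ʳ e j rewrite ends-↑ˡ e =
    cong₂ _∨_ (dec-false (_ Fin.≟ _) (↑ˡ≢↑ʳ (proj₁ (ends G e)) j))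
              (dec-false (_ Fin.≟ _) (↑ˡ≢↑ʳ (proj₂ (ends G e)) j))

  incident-↑ʳ-↑ˡ : ∀ i v → incident H (M ↑ʳ i) (v ↑ˡ c) ≡ does (lookup L i Fin.≟ v)
  incident-↑ʳ-↑ˡ i v rewrite ends-↑ʳ i
    | does-≟-injective (_↑ˡ c) (Fin.↑ˡ-injective c _ _) (lookup L i) v
    | dec-false (N ↑ʳ i Fin.≟ v ↑ˡ c) (↑ˡ≢↑ʳ v i ∘ sym) = ∨-identityʳ _

  incident-↑ʳ-↑ʳ : ∀ i j → incident H (M ↑ʳ i) (N ↑ʳ j) ≡ does (i Fin.≟ j)
  incident-↑ʳ-↑ʳ i j rewrite ends-↑ʳ i =
    cong₂ _∨_ (dec-false (_ Fin.≟ _) (↑ˡ≢↑ʳ (lookup L i) j))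
              (does-≟-injective (N ↑ʳ_) (Fin.↑ʳ-injective N _ _) i j)

  pendantSum : (Fin c → ℕ) → Fin N → ℕ
  pendantSum w v = ∑[ i < c ] (if does (lookup L i Fin.≟ v) then w i else 0)

  incidenceSum-↑ˡ : ∀ w v →
    incidenceSum H w (v ↑ˡ c) ≡ incidenceSum G (w ∘ (_↑ˡ c)) v + pendantSum (w ∘ (M ↑ʳ_)) v
  incidenceSum-↑ˡ w v = trans (sum-↑ {M} _) (cong₂ _+_
    (sum-cong-≗ (λ e → if-cong (incident-↑ˡ-↑ˡ e v)))
    (sum-cong-≗ (λ i → if-cong (incident-↑ʳ-↑ˡ i v))))

  incidenceSum-↑ʳ : ∀ w j → incidenceSum H w (N ↑ʳ j) ≡ w (M ↑ʳ j)
  incidenceSum-↑ʳ w j = trans (sum-↑ {M} _) (cong₂ _+_ old-edges new-edges)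
    where
    old-edges : ∑[ e < M ] (if incident H (e ↑ˡ c) (N ↑ʳ j) then w (e ↑ˡ c) else 0) ≡ 0
    old-edges = trans (sum-cong-≗ (λ e → if-cong (incident-↑ˡ-↑ʳ e j))) (sum-replicate-zero M)
    new-edges : ∑[ i < c ] (if incident H (M ↑ʳ i) (N ↑ʳ j) then w (M ↑ʳ i) else 0) ≡ w (M ↑ʳ j)
    new-edges = trans
      (sum-point _ j (λ i i≢j → if-cong (trans (incident-↑ʳ-↑ʳ i j) (dec-false (i Fin.≟ j) i≢j))))
      (if-cong (trans (incident-↑ʳ-↑ʳ j j) (dec-true (j Fin.≟ j) refl)))

  pendantSum-cong : ∀ {w w′} → (∀ i → w i ≡ w′ i) → ∀ v → pendantSum w v ≡ pendantSum w′ v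
  pendantSum-cong w≗w′ v = sum-cong-≗ (λ i → cong (if does (lookup L i Fin.≟ v) then_else 0) (w≗w′ i))

  deg-lookup : ∀ i → deg G (lookup L i) ≡ k
  deg-lookup i = proj₂ (∈-filter⁻ (λ v → deg G v ℕ.≟ k) {xs = allFin N} (∈-lookup i))

  lookup-injective : Injective _≡_ _≡_ (lookup L)
  lookup-injective = Unique⇒lookup-injective (Unique.filter⁺ (λ v → deg G v ℕ.≟ k) (Unique.allFin⁺ N))

  data Attachment (v : Fin N) : Set where
    attached : (i : Fin c) → lookup L i ≡ v → Attachment v
    bare     : deg G v ≢ k → Attachment v

  attachment : ∀ v → Attachment v
  attachment v with deg G v ℕ.≟ k
  ... | no  deg≢k = bare deg≢k
  ... | yes deg≡k = attached (index v∈L) (sym (lookup-index v∈L))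
    where
    v∈L : v ∈ L
    v∈L = ∈-filter⁺ (λ v → deg G v ℕ.≟ k) {xs = allFin N} (∈-allFin v) deg≡k

  pendantSum-attached : ∀ w {i v} → lookup L i ≡ v → pendantSum w v ≡ w i
  pendantSum-attached w {i} {v} refl =
    trans (sum-point _ i (λ j j≢i → if-cong (dec-false (lookup L j Fin.≟ v) (j≢i ∘ lookup-injective))))
          (if-cong (dec-true (lookup L i Fin.≟ v) refl))

  pendantSum-bare : ∀ w {v} → deg G v ≢ k → pendantSum w v ≡ 0
  pendantSum-bare w {v} deg≢k =
    trans (sum-cong-≗ (λ i → if-cong (dec-false (lookup L i Fin.≟ v) (λ { refl → deg≢k (deg-lookup i) }))))
          (sum-replicate-zero c)

  pendantSum-sameDegree : (R : ℕ → ℕ → Set) (w : Fin c → ℕ) {u v : Fin N} → deg G u ≡ deg G v →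
    R 0 0 → (∀ {i j} → lookup L i ≡ u → lookup L j ≡ v → R (w i) (w j)) →
    R (pendantSum w u) (pendantSum w v)
  pendantSum-sameDegree R w {u} {v} du≡dv R00 Rw with attachment u | attachment v
  ... | attached i Lᵢ≡u | attached j Lⱼ≡v =
    subst₂ R (sym (pendantSum-attached w Lᵢ≡u)) (sym (pendantSum-attached w Lⱼ≡v)) (Rw Lᵢ≡u Lⱼ≡v)
  ... | attached i refl | bare dv≢k = contradiction (trans (sym du≡dv) (deg-lookup i)) dv≢k
  ... | bare du≢k | attached j refl = contradiction (trans du≡dv (deg-lookup j)) du≢k
  ... | bare du≢k | bare dv≢k =
    subst₂ R (sym (pendantSum-bare w du≢k)) (sym (pendantSum-bare w dv≢k)) R00

module PendantLabelling (G : Graph) (f : Fin (m G) ⤖ Fin (m G))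
  (antimagic : IsStronglyAntimagicLabeling G f) (k : ℕ) (1≤k : 1 ≤ k) where

  open Pendants G k

  φ-injective : Injective _≡_ _≡_ (φ G f)
  φ-injective {u} {v} φu≡φv with u Fin.≟ v
  ... | yes u≡v = u≡v
  ... | no  u≢v = contradiction φu≡φv (proj₁ antimagic u v u≢v)

  ψ : Fin c → ℕ
  ψ = φ G f ∘ lookup L

  ψ-injective : Injective _≡_ _≡_ ψ
  ψ-injective = lookup-injective ∘ φ-injective

  newLabel : Fin (M + c) → ℕ
  newLabel = [ (λ e → c + toℕ (Bijection.to f e)) , rank ψ ]′ ∘ Fin.splitAt M

  newLabel-↑ˡ : ∀ e → newLabel (e ↑ˡ c) ≡ c + toℕ (Bijection.to f e)
  newLabel-↑ˡ e = cong [ _ , _ ]′ (Fin.splitAt-↑ˡ M e c)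

  newLabel-↑ʳ : ∀ i → newLabel (M ↑ʳ i) ≡ rank ψ i
  newLabel-↑ʳ i = cong [ _ , _ ]′ (Fin.splitAt-↑ʳ M c i)

  newLabel<M+c : ∀ x → newLabel x < M + c
  newLabel<M+c x with ↑-view M x
  ... | ↑ˡ-view e = begin-strict
    newLabel (e ↑ˡ c)          ≡⟨ newLabel-↑ˡ e ⟩
    c + toℕ (Bijection.to f e) <⟨ +-monoʳ-< c (Fin.toℕ<n (Bijection.to f e)) ⟩
    c + M                      ≡⟨ +-comm c M ⟩
    M + c                      ∎
    where open ≤-Reasoning
  ... | ↑ʳ-view i = begin-strict
    newLabel (M ↑ʳ i) ≡⟨ newLabel-↑ʳ i ⟩
    rank ψ i          <⟨ rank<size ψ i ⟩
    c                 ≤⟨ m≤n+m c M ⟩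
    M + c             ∎
    where open ≤-Reasoning

  rank<newLabel-↑ˡ : ∀ i e → rank ψ i < newLabel (e ↑ˡ c)
  rank<newLabel-↑ˡ i e = subst (rank ψ i <_) (sym (newLabel-↑ˡ e)) (≤-trans (rank<size ψ i) (m≤m+n c _))

  newLabel-injective : Injective _≡_ _≡_ newLabel
  newLabel-injective {x} {y} eq with ↑-view M x | ↑-view M y
  ... | ↑ˡ-view e | ↑ˡ-view e′ = cong (_↑ˡ c) (Bijection.injective f (Fin.toℕ-injective
    (+-cancelˡ-≡ c _ _ (trans (sym (newLabel-↑ˡ e)) (trans eq (newLabel-↑ˡ e′))))))
  ... | ↑ˡ-view e | ↑ʳ-view j =
    contradiction (trans (sym (newLabel-↑ʳ j)) (sym eq)) (<⇒≢ (rank<newLabel-↑ˡ j e))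
  ... | ↑ʳ-view i | ↑ˡ-view e =
    contradiction (trans (sym (newLabel-↑ʳ i)) eq) (<⇒≢ (rank<newLabel-↑ˡ i e))
  ... | ↑ʳ-view i | ↑ʳ-view j =
    cong (M ↑ʳ_) (rank-injective ψ ψ-injective (trans (sym (newLabel-↑ʳ i)) (trans eq (newLabel-↑ʳ j))))

  f′ : Fin (M + c) ⤖ Fin (M + c)
  f′ = injective⇒bijection (λ x → fromℕ< (newLabel<M+c x))
    (λ eq → newLabel-injective (trans (sym (Fin.toℕ-fromℕ< _)) (trans (cong toℕ eq) (Fin.toℕ-fromℕ< _))))

  label-f′ : ∀ x → label H f′ x ≡ suc (newLabel x)
  label-f′ x = cong suc (Fin.toℕ-fromℕ< (newLabel<M+c x))

  ε : Fin N → ℕ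
  ε = pendantSum (suc ∘ rank ψ)

  φ′-↑ˡ : ∀ v → φ H f′ (v ↑ˡ c) ≡ φ G f v + c * deg G v + ε v
  φ′-↑ˡ v = begin
    φ H f′ (v ↑ˡ c)
      ≡⟨ φ≡incidenceSum H f′ (v ↑ˡ c) ⟩
    incidenceSum H (label H f′) (v ↑ˡ c)
      ≡⟨ incidenceSum-↑ˡ (label H f′) v ⟩
    incidenceSum G (label H f′ ∘ (_↑ˡ c)) v + pendantSum (label H f′ ∘ (M ↑ʳ_)) v
      ≡⟨ cong₂ _+_ (incidenceSum-cong G old-label v) (pendantSum-cong new-label v) ⟩
    incidenceSum G (λ e → label G f e + c * 1) v + ε v
      ≡⟨ cong (_+ ε v) (incidenceSum-+ G (label G f) (λ _ → c * 1) v) ⟩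
    incidenceSum G (label G f) v + incidenceSum G (λ _ → c * 1) v + ε v
      ≡⟨ cong₂ (λ a b → a + b + ε v) (φ≡incidenceSum G f v) (sym (incidenceSum-* G c (λ _ → 1) v)) ⟨
    φ G f v + c * incidenceSum G (λ _ → 1) v + ε v
      ≡⟨ cong (λ d → φ G f v + c * d + ε v) (deg≡incidenceSum G v) ⟨
    φ G f v + c * deg G v + ε v
      ∎
    where
    open ≡-Reasoning
    old-label : ∀ e → label H f′ (e ↑ˡ c) ≡ label G f e + c * 1
    old-label e = begin
      label H f′ (e ↑ˡ c)              ≡⟨ label-f′ (e ↑ˡ c) ⟩
      suc (newLabel (e ↑ˡ c))          ≡⟨ cong suc (newLabel-↑ˡ e) ⟩
      suc (c + toℕ (Bijection.to f e)) ≡⟨ +-suc c _ ⟨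
      c + label G f e                  ≡⟨ +-comm c _ ⟩
      label G f e + c                  ≡⟨ cong (label G f e +_) (*-identityʳ c) ⟨
      label G f e + c * 1              ∎
    new-label : ∀ i → label H f′ (M ↑ʳ i) ≡ suc (rank ψ i)
    new-label i = trans (label-f′ (M ↑ʳ i)) (cong suc (newLabel-↑ʳ i))

  φ′-↑ʳ : ∀ i → φ H f′ (N ↑ʳ i) ≡ suc (rank ψ i)
  φ′-↑ʳ i = begin
    φ H f′ (N ↑ʳ i)                      ≡⟨ φ≡incidenceSum H f′ (N ↑ʳ i) ⟩
    incidenceSum H (label H f′) (N ↑ʳ i) ≡⟨ incidenceSum-↑ʳ (label H f′) i ⟩
    label H f′ (M ↑ʳ i)                  ≡⟨ label-f′ (M ↑ʳ i) ⟩
    suc (newLabel (M ↑ʳ i))              ≡⟨ cong suc (newLabel-↑ʳ i) ⟩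
    suc (rank ψ i)                       ∎
    where open ≡-Reasoning

  deg′-↑ˡ : ∀ v → deg H (v ↑ˡ c) ≡ deg G v + pendantSum (λ _ → 1) v
  deg′-↑ˡ v = trans (deg≡incidenceSum H (v ↑ˡ c))
    (trans (incidenceSum-↑ˡ (λ _ → 1) v) (cong (_+ pendantSum (λ _ → 1) v) (sym (deg≡incidenceSum G v))))

  deg≤deg′ : ∀ v → deg G v ≤ deg H (v ↑ˡ c)
  deg≤deg′ v = subst (deg G v ≤_) (sym (deg′-↑ˡ v)) (m≤m+n (deg G v) _)

  deg′-↑ʳ : ∀ i → deg H (N ↑ʳ i) ≡ 1
  deg′-↑ʳ i = trans (deg≡incidenceSum H (N ↑ʳ i)) (incidenceSum-↑ʳ (λ _ → 1) i)

  ε≤c : ∀ v → ε v ≤ c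
  ε≤c v with attachment v
  ... | attached i Lᵢ≡v = subst (_≤ c) (sym (pendantSum-attached _ Lᵢ≡v)) (rank<size ψ i)
  ... | bare deg≢k      = subst (_≤ c) (sym (pendantSum-bare _ deg≢k)) z≤n

  ε-mono : ∀ {u v} → deg G u ≡ deg G v → φ G f u < φ G f v → ε u ≤ ε v
  ε-mono du≡dv φu<φv = pendantSum-sameDegree _≤_ _ du≡dv z≤n
    (λ { refl refl → s≤s (<⇒≤ (rank-mono-< ψ φu<φv)) })

  deg′-mono : ∀ {u v} → deg G u ≤ deg G v → deg H (u ↑ˡ c) ≤ deg H (v ↑ˡ c)
  deg′-mono {u} {v} du≤dv with m≤n⇒m<n∨m≡n du≤dv
  ... | inj₂ du≡dv = subst₂ _≤_ (sym (deg′-↑ˡ u)) (sym (deg′-↑ˡ v))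
    (+-mono-≤ (≤-reflexive du≡dv) (pendantSum-sameDegree _≤_ _ du≡dv z≤n (λ _ _ → ≤-refl)))
  ... | inj₁ du<dv = begin
    deg H (u ↑ˡ c)                       ≡⟨ deg′-↑ˡ u ⟩
    deg G u + pendantSum (λ _ → 1) u     ≤⟨ +-monoʳ-≤ (deg G u) (pendantSum≤1 u) ⟩
    deg G u + 1                          ≡⟨ +-comm (deg G u) 1 ⟩
    suc (deg G u)                        ≤⟨ du<dv ⟩
    deg G v                              ≤⟨ m≤m+n (deg G v) _ ⟩
    deg G v + pendantSum (λ _ → 1) v     ≡⟨ deg′-↑ˡ v ⟨
    deg H (v ↑ˡ c)                       ∎
    where
    open ≤-Reasoning
    pendantSum≤1 : ∀ v → pendantSum (λ _ → 1) v ≤ 1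
    pendantSum≤1 v with attachment v
    ... | attached i Lᵢ≡v = ≤-reflexive (pendantSum-attached _ Lᵢ≡v)
    ... | bare deg≢k      = subst (_≤ 1) (sym (pendantSum-bare _ deg≢k)) z≤n

  φ′-lex-mono : ∀ {u v} → deg G u < deg G v ⊎ (deg G u ≡ deg G v × φ G f u < φ G f v) →
    φ H f′ (u ↑ˡ c) < φ H f′ (v ↑ˡ c)
  φ′-lex-mono {u} {v} (inj₁ du<dv) = begin-strict
    φ H f′ (u ↑ˡ c)                   ≡⟨ φ′-↑ˡ u ⟩
    φ G f u + c * deg G u + ε u       ≤⟨ +-monoʳ-≤ (φ G f u + c * deg G u) (ε≤c u) ⟩
    φ G f u + c * deg G u + c         ≡⟨ +-assoc (φ G f u) _ c ⟩
    φ G f u + (c * deg G u + c)       ≡⟨ cong (φ G f u +_) (trans (+-comm _ c) (sym (*-suc c (deg G u)))) ⟩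
    φ G f u + c * suc (deg G u)       ≤⟨ +-monoʳ-≤ (φ G f u) (*-monoʳ-≤ c du<dv) ⟩
    φ G f u + c * deg G v             <⟨ +-monoˡ-< (c * deg G v) (proj₂ antimagic u v du<dv) ⟩
    φ G f v + c * deg G v             ≤⟨ m≤m+n _ (ε v) ⟩
    φ G f v + c * deg G v + ε v       ≡⟨ φ′-↑ˡ v ⟨
    φ H f′ (v ↑ˡ c)                   ∎
    where open ≤-Reasoning
  φ′-lex-mono {u} {v} (inj₂ (du≡dv , φu<φv)) = subst₂ _<_ (sym (φ′-↑ˡ u)) (sym (φ′-↑ˡ v))
    (+-mono-<-≤ (+-mono-<-≤ φu<φv (≤-reflexive (cong (c *_) du≡dv))) (ε-mono du≡dv φu<φv))

  φ′-↑ˡ-injective : ∀ {u v} → u ≢ v → φ H f′ (u ↑ˡ c) ≢ φ H f′ (v ↑ˡ c)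
  φ′-↑ˡ-injective {u} {v} u≢v with <-cmp (deg G u) (deg G v) | <-cmp (φ G f u) (φ G f v)
  ... | tri< du<dv _ _ | _ = <⇒≢ (φ′-lex-mono (inj₁ du<dv))
  ... | tri> _ _ dv<du | _ = ≢-sym (<⇒≢ (φ′-lex-mono (inj₁ dv<du)))
  ... | tri≈ _ du≡dv _ | tri< φu<φv _ _ = <⇒≢ (φ′-lex-mono (inj₂ (du≡dv , φu<φv)))
  ... | tri≈ _ du≡dv _ | tri> _ _ φv<φu = ≢-sym (<⇒≢ (φ′-lex-mono (inj₂ (sym du≡dv , φv<φu))))
  ... | tri≈ _ _ _     | tri≈ _ φu≡φv _ = contradiction φu≡φv (proj₁ antimagic u v u≢v)

  φ′-↑ˡ-mono : ∀ {u v} → deg H (u ↑ˡ c) < deg H (v ↑ˡ c) → φ H f′ (u ↑ˡ c) < φ H f′ (v ↑ˡ c)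
  φ′-↑ˡ-mono {u} {v} d′u<d′v = φ′-lex-mono (inj₁ (≰⇒> (λ dv≤du → <⇒≱ d′u<d′v (deg′-mono dv≤du))))

  isolated : ∀ {v} → deg G v ≡ 0 → deg H (v ↑ˡ c) ≡ 0 × φ H f′ (v ↑ˡ c) ≡ 0
  isolated {v} dv≡0 =
    trans (deg′-↑ˡ v) (cong₂ _+_ dv≡0 (pendantSum-bare _ dv≢k)) ,
    trans (φ′-↑ˡ v) (cong₂ _+_ (cong₂ _+_ φv≡0 c*dv≡0) (pendantSum-bare _ dv≢k))
    where
    dv≢k : deg G v ≢ k
    dv≢k dv≡k = <⇒≢ 1≤k (trans (sym dv≡0) dv≡k)
    φv≡0 : φ G f v ≡ 0
    φv≡0 = n≤0⇒n≡0 (subst (φ G f v ≤_) (trans (cong (M *_) dv≡0) (*-zeroʳ M)) (φ≤m*deg G f v))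
    c*dv≡0 : c * deg G v ≡ 0
    c*dv≡0 = trans (cong (c *_) dv≡0) (*-zeroʳ c)

  c<φ′ : ∀ {v} → 1 ≤ deg G v → c < φ H f′ (v ↑ˡ c)
  c<φ′ {v} 1≤dv = begin-strict
    c                            <⟨ n<1+n c ⟩
    1 + c                        ≡⟨ cong suc (*-identityʳ c) ⟨
    1 + c * 1                    ≤⟨ +-mono-≤ (≤-trans 1≤dv (deg≤φ G f v)) (*-monoʳ-≤ c 1≤dv) ⟩
    φ G f v + c * deg G v        ≤⟨ m≤m+n _ (ε v) ⟩
    φ G f v + c * deg G v + ε v  ≡⟨ φ′-↑ˡ v ⟨
    φ H f′ (v ↑ˡ c)              ∎
    where open ≤-Reasoning

  φ′-↑ʳ≤c : ∀ i → φ H f′ (N ↑ʳ i) ≤ c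
  φ′-↑ʳ≤c i = subst (_≤ c) (sym (φ′-↑ʳ i)) (rank<size ψ i)

  φ′-↑ˡ≢φ′-↑ʳ : ∀ v i → φ H f′ (v ↑ˡ c) ≢ φ H f′ (N ↑ʳ i)
  φ′-↑ˡ≢φ′-↑ʳ v i with deg G v in dv
  ... | zero  = λ eq → 0≢1+n (trans (sym (proj₂ (isolated dv))) (trans eq (φ′-↑ʳ i)))
  ... | suc _ = ≢-sym (<⇒≢ (≤-<-trans (φ′-↑ʳ≤c i) (c<φ′ (subst (1 ≤_) (sym dv) (s≤s z≤n)))))

  φ′-injective : ∀ x y → x ≢ y → φ H f′ x ≢ φ H f′ y
  φ′-injective x y x≢y with ↑-view N x | ↑-view N y
  ... | ↑ˡ-view u | ↑ˡ-view v = φ′-↑ˡ-injective (x≢y ∘ cong (_↑ˡ c))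
  ... | ↑ˡ-view u | ↑ʳ-view j = φ′-↑ˡ≢φ′-↑ʳ u j
  ... | ↑ʳ-view i | ↑ˡ-view v = ≢-sym (φ′-↑ˡ≢φ′-↑ʳ v i)
  ... | ↑ʳ-view i | ↑ʳ-view j = λ eq → x≢y (cong (N ↑ʳ_) (rank-injective ψ ψ-injective
    (suc-injective (trans (sym (φ′-↑ʳ i)) (trans eq (φ′-↑ʳ j))))))

  φ′-mono : ∀ x y → deg H x < deg H y → φ H f′ x < φ H f′ y
  φ′-mono x y dx<dy with ↑-view N x | ↑-view N y
  ... | ↑ˡ-view u | ↑ˡ-view v = φ′-↑ˡ-mono dx<dy
  ... | ↑ˡ-view u | ↑ʳ-view j = subst₂ _<_ (sym (proj₂ (isolated du≡0))) (sym (φ′-↑ʳ j)) (s≤s z≤n)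
    where
    du≡0 : deg G u ≡ 0
    du≡0 = n≤0⇒n≡0 (≤-trans (deg≤deg′ u) (s≤s⁻¹ (subst (_ <_) (deg′-↑ʳ j) dx<dy)))
  ... | ↑ʳ-view i | ↑ˡ-view v = ≤-<-trans (φ′-↑ʳ≤c i) (c<φ′ 1≤dv)
    where
    1≤dv : 1 ≤ deg G v
    1≤dv = ≰⇒> (λ dv≤0 → <⇒≱ dx<dy
      (subst₂ _≤_ (sym (proj₁ (isolated (n≤0⇒n≡0 dv≤0)))) (sym (deg′-↑ʳ i)) z≤n))
  ... | ↑ʳ-view i | ↑ʳ-view j = contradiction (trans (deg′-↑ʳ i) (sym (deg′-↑ʳ j))) (<⇒≢ dx<dy)

theorem8 : (G : Graph) → IsSimple G → StronglyAntimagic G →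
    (k : ℕ) → 1 ≤ k → StronglyAntimagic (addPendants G k)
theorem8 G _ (f , antimagic) k 1≤k = f′ , φ′-injective , φ′-mono
  where open PendantLabelling G f antimagic k 1≤k
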